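{- Let $a,b$ be positive integers with $\gcd(a,b)=1$ and let $\pi\in\mathcal{D}_{b,-a}(a,b)$. Let $z=z_0z_1z_2\cdots$ be the word with $z_0=\mathrm{E}$ and, for $i>0$, $z_i=\mathrm{N}$ if $i\in\Delta^c(\pi)$ and $z_i=\mathrm{E}$ otherwise. Let $y$ be the subword of $z$ obtained by retaining exactly those $z_i$ ($i\ge0$) for which $i+a$ is the west-south level of some step of the path of $\pi$, and let $\tilde\rho(\tilde f(\pi))$ be the partition whose parts are, for each letter $\mathrm{N}$ of $y$, the number of letters $\mathrm{E}$ preceding it in $y$. Then $$\mathrm{word}(\tilde\rho(\tilde f(\pi)))=\mathrm{sw}^{+}_{b,-a}\circ\mathrm{rev}(\mathrm{word}(\pi)).$$
   Context: A partition $\lambda$ with at most $a$ parts and largest part at most $b$ is identified with the set of unit squares of $[0,b]\times[0,a]$ lying northwest of a lattice path from $(0,0)$ to $(b,a)$ with unit north ($\mathrm{N}$) and east ($\mathrm{E}$) steps (its path); $\mathrm{word}(\lambda)$ is the word of that path (with $a$ letters $\mathrm{N}$ and $b$ letters $\mathrm{E}$). $\mathrm{rev}$ reverses a word. The level of a lattice point $(x,y)$ is $by-ax$; a unit lattice square has the level of its southeast corner; the west-south level of a step of a path is the level of its starting point (its western endpoint for an east step, southern endpoint for a north step). $\mathcal{D}_{b,-a}(a,b)$ is the set of such partitions whose path visits only points of level $\ge0$. $\Delta^c(\pi)$ is the set of levels of unit squares of the rectangle lying southeast of the path of $\pi$ and above the line $by=ax$. $\tilde f(\pi)$ denotes the partition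 whose parts are, for each $z_i=\mathrm{N}$, the number of $\mathrm{E}$'s among $z_0,\dots,z_{i-1}$. $\mathrm{sw}^+_{b,-a}$: for a word $u=u_1\cdots u_N$ set $l_0=0$, $l_i=l_{i-1}+b$ if $u_i=\mathrm{N}$, $l_i=l_{i-1}-a$ if $u_i=\mathrm{E}$; the output is obtained by taking $k=0$, then $k=-1,-2,\dots$, then all positive $k$ in decreasing order, and for each $k$ scanning $u$ from left to right, appending each $u_i$ ($i\ge1$) with $l_i=k$. -}

module Defs where

open import Data.Bool using (Bool; true; false; if_then_else_)
open import Data.Nat as ℕ using (ℕ; zero; suc; _∸_; _<ᵇ_)
open import Data.Integer as ℤ using (ℤ; +_; 0ℤ; _≤ᵇ_)
open import Data.Product using (_×_; _,_; proj₁; proj₂)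
open import Data.List using (List; []; _∷_; _++_; map; filterᵇ; concatMap; upTo; length; replicate; reverse)
open import Data.List.Relation.Unary.All using (All)
open import Data.Bool.ListAction using (any)
open import Relation.Nullary.Decidable using (⌊_⌋)
open import Relation.Binary.PropositionalEquality using (_≡_)

data Step : Set where
  N E : Step

isN isE : Step → Bool
isN N = true
isN E = false
isE N = false
isE E = true

count : (Step → Bool) → List Step → ℕ
count p w = length (filterᵇ p w)

level : ℕ → ℕ → ℕ × ℕ → ℤ
level a b (x , y) = (+ (b ℕ.* y)) ℤ.- (+ (a ℕ.* x))

move : ℕ × ℕ → Step → ℕ × ℕ
move (x , y) N = (x , suc y)
move (x , y) E = (suc x , y)

visited : ℕ × ℕ → List Step → List (ℕ × ℕ)
visited p [] = p ∷ []
visited p (s ∷ w) = p ∷ visited (move p s) w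

-- starting points of the steps (west endpoint of an E step, south endpoint of an N step)
starts : ℕ × ℕ → List Step → List (ℕ × ℕ)
starts p [] = []
starts p (s ∷ w) = p ∷ starts (move p s) w

-- π ∈ D_{b,-a}(a,b), with π identified with (the word of) its path from (0,0) to (b,a)
InD : ℕ → ℕ → List Step → Set
InD a b w = (count isN w ≡ a) × (count isE w ≡ b)
            × All (λ p → ℤ.0ℤ ℤ.≤ level a b p) (visited (0 , 0) w)

-- number of E steps before the (j+1)-th N step; the N step of the path in the
-- row between heights j and j+1 has x-coordinate eastBeforeN w j
eastBeforeN : List Step → ℕ → ℕ
eastBeforeN [] j = 0
eastBeforeN (E ∷ w) j = suc (eastBeforeN w j)
eastBeforeN (N ∷ w) zero = 0
eastBeforeN (N ∷ w) (suc j) = eastBeforeN w j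

-- unit squares [x-1,x]×[y,y+1] of [0,b]×[0,a], given by their SE corner (x , y),
-- with 1 ≤ x ≤ b, 0 ≤ y < a, lying southeast of the path (x - 1 ≥ eastBeforeN w y)
squaresSE : ℕ → ℕ → List Step → List (ℕ × ℕ)
squaresSE a b w =
  concatMap (λ y → filterᵇ (λ c → eastBeforeN w y <ᵇ proj₁ c)
                           (map (λ x → (suc x , y)) (upTo b)))
            (upTo a)

-- Δ^c(π): levels of squares SE of the path and above the line by = ax
-- (square lies above the line iff its SE corner, its lowest-level point, has level ≥ 0)
deltaC : ℕ → ℕ → List Step → List ℤ
deltaC a b w = map (level a b) (filterᵇ (λ s → 0ℤ ≤ᵇ level a b s) (squaresSE a b w))

memℤ : ℤ → List ℤ → Bool
memℤ i l = any (λ j → ⌊ i ℤ.≟ j ⌋) l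

zWord : ℕ → ℕ → List Step → ℕ → Step
zWord a b w zero = E
zWord a b w (suc i) = if memℤ (+ suc i) (deltaC a b w) then N else E

wsLevels : ℕ → ℕ → List Step → List ℤ
wsLevels a b w = map (level a b) (starts (0 , 0) w)

-- the subword y of z: keep z_i (i ≥ 0) iff i + a is a west-south level.
-- Levels of path points are ≤ a*b, so all such i lie in [0, a*b].
yWord : ℕ → ℕ → List Step → List Step
yWord a b w =
  map (zWord a b w)
      (filterᵇ (λ i → memℤ (+ (i ℕ.+ a)) (wsLevels a b w)) (upTo (suc (a ℕ.* b))))

eBeforeEachN : ℕ → List Step → List ℕ
eBeforeEachN c [] = []
eBeforeEachN c (E ∷ u) = eBeforeEachN (suc c) u
eBeforeEachN c (N ∷ u) = c ∷ eBeforeEachN c u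

-- a partition is a weakly decreasing list of positive parts
-- ρ̃(f̃(π)): parts = number of E's before each N of y (zero "parts" dropped)
rhoTildeFTilde : ℕ → ℕ → List Step → List ℕ
rhoTildeFTilde a b w = reverse (filterᵇ (λ p → 0 <ᵇ p) (eBeforeEachN 0 (yWord a b w)))

-- word of a partition λ (parts weakly decreasing) in the a × b rectangle:
-- the N step in row j (from the bottom) is preceded by λ_{a+1-j} E steps.
pathFrom : ℕ → ℕ → List ℕ → List Step
pathFrom b prev [] = replicate (b ∸ prev) E
pathFrom b prev (p ∷ ps) = replicate (p ∸ prev) E ++ (N ∷ pathFrom b p ps)

wordPart : ℕ → ℕ → List ℕ → List Step
wordPart a b λ' = pathFrom b 0 (replicate (a ∸ length λ') 0 ++ reverse λ')

stepVal : ℕ → ℕ → Step → ℤ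
stepVal a b N = + b
stepVal a b E = ℤ.- (+ a)

labelled : ℕ → ℕ → ℤ → List Step → List (ℤ × Step)
labelled a b l [] = []
labelled a b l (s ∷ u) = (l ℤ.+ stepVal a b s , s) ∷ labelled a b (l ℤ.+ stepVal a b s) u

-- order of the k's: 0, -1, ..., -K, then K, K-1, ..., 1, where K = (a+b)*length u
-- bounds every |l_i|, so this enumerates all occurring values in the required order
swOrder : ℕ → List ℤ
swOrder K = map (λ j → ℤ.- (+ j)) (upTo (suc K)) ++ map (λ j → + (K ∸ j)) (upTo K)

swPlus : ℕ → ℕ → List Step → List Step
swPlus a b u =
  concatMap (λ k → map proj₂ (filterᵇ (λ p → ⌊ proj₁ p ℤ.≟ k ⌋) (labelled a b 0ℤ u)))
            (swOrder ((a ℕ.+ b) ℕ.* length u))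

-- Idea.  Because a and b are coprime, the level b·y - a·x is injective on the
-- lattice points of the rectangle except for the pair (0,0), (b,a); since (b,a)
-- starts no step, the steps of π start at pairwise distinct levels.  Write S j
-- for the step of π starting at level j (a list with at most one letter).
--  (1) The labels l_i that sw⁺ attaches to rev π are the negated starting levels
--      of the steps, all ≤ 0, so sw⁺(rev π) = S 0 ++ S 1 ++ ⋯ .
--  (2) Steps starting below level a are north steps (an east step would end
--      below level 0) and no step starts above level a·b, so
--      sw⁺(rev π) = N^k ++ S a ++ ⋯ ++ S (a + a·b).
--  (3) z_i is the step starting at level a + i, whenever there is one: for i = 0
--      it is an east step by coprimality, for i > 0 the unit square east of its
--      starting point lies in Δ^c(π) exactly for north steps.  Hence the word y
--      of the statement is S a ++ ⋯ ++ S (a + a·b).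
--  (4) Every step lies in exactly one bucket S j, so y has a - k letters N and
--      b letters E; for any such word the path of its partition is N^k ++ y.

module Submission where

open import Defs
open import Data.Nat using (ℕ; _≤_)
open import Data.Nat.GCD using (gcd)
open import Data.List using (List; reverse)
open import Relation.Binary.PropositionalEquality using (_≡_)

open import Data.Bool using (Bool; true; false; if_then_else_; T)
open import Data.Bool.Properties using (T?)
open import Data.Nat as ℕ using (zero; suc; _+_; _*_; _∸_; _<_; s≤s)
import Data.Nat.Properties as ℕP
open import Data.Nat.Divisibility using (_∣_; divides; ∣m+n∣m⇒∣n; ∣⇒≤; m∣m*n)
open import Data.Nat.Coprimality using (Coprime; gcd≡1⇒coprime; coprime-divisor)
open import Algebra.Properties.CommutativeSemigroup ℕP.+-commutativeSemigroup using (interchange)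
open import Data.Integer as ℤ using (ℤ; +_; 0ℤ)
import Data.Integer.Properties as ℤP
open import Data.Integer.Tactic.RingSolver using (solve-∀)
import Data.Nat.Tactic.RingSolver as ℕSolver
open import Data.Product using (_×_; _,_; proj₁; proj₂; ∃-syntax)
open import Data.Sum using (_⊎_; inj₁; inj₂)
open import Data.Empty using (⊥-elim)
open import Data.List using ([]; _∷_; _++_; [_]; map; filterᵇ; concat; concatMap; upTo; applyUpTo; length; replicate)
import Data.List.Properties as ListP
import Data.List.Relation.Unary.All.Properties as AllP
open import Data.List.Relation.Unary.All as All using (All; []; _∷_)
open import Data.List.Relation.Unary.Any as Any using (here; there)
open import Data.List.Relation.Unary.AllPairs using (AllPairs; []; _∷_)
open import Data.List.Membership.Propositional using (_∈_; find)
import Data.List.Membership.Propositional.Properties as ∈P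
open import Relation.Binary.PropositionalEquality using (_≢_; refl; sym; trans; cong; cong₂; subst; subst₂; module ≡-Reasoning)
open import Relation.Nullary using (¬_; yes; no)
open import Relation.Unary using (Decidable)
open import Relation.Nullary.Decidable using (⌊_⌋; toWitness; fromWitness; isYes≗does; does-⇔)
open import Function.Bundles using (mk⇔)
open import Function using (_∘_; id)

open ≡-Reasoning

module _ {A B : Set} where

  map-filterᵇ-∷ : (p : A → Bool) (f : A → B) (x : A) (xs : List A) →
    map f (filterᵇ p (x ∷ xs)) ≡ (if p x then [ f x ] else []) ++ map f (filterᵇ p xs)
  map-filterᵇ-∷ p f x xs with p x
  ... | true  = refl
  ... | false = refl

  map-filterᵇ : (p : A → Bool) (f : A → B) (xs : List A) →
    map f (filterᵇ p xs) ≡ concatMap (λ x → if p x then [ f x ] else []) xs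
  map-filterᵇ p f [] = refl
  map-filterᵇ p f (x ∷ xs) = trans (map-filterᵇ-∷ p f x xs) (cong (_ ++_) (map-filterᵇ p f xs))

  filterᵇ-map : (p : B → Bool) (g : A → B) (xs : List A) →
    filterᵇ p (map g xs) ≡ map g (filterᵇ (p ∘ g) xs)
  filterᵇ-map p g [] = refl
  filterᵇ-map p g (x ∷ xs) with p (g x)
  ... | true  = cong (g x ∷_) (filterᵇ-map p g xs)
  ... | false = filterᵇ-map p g xs

  concatMap-cong-∈ : {f g : A → List B} (xs : List A) → (∀ {x} → x ∈ xs → f x ≡ g x) →
    concatMap f xs ≡ concatMap g xs
  concatMap-cong-∈ xs f≡g = cong concat (ListP.map-cong-local (All.tabulate f≡g))

  concatMap-[] : (xs : List A) → concatMap {B = B} (λ _ → []) xs ≡ []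
  concatMap-[] [] = refl
  concatMap-[] (x ∷ xs) = concatMap-[] xs

module _ {A : Set} where

  filterᵇ-reverse : (p : A → Bool) (xs : List A) → filterᵇ p (reverse xs) ≡ reverse (filterᵇ p xs)
  filterᵇ-reverse p [] = refl
  filterᵇ-reverse p (x ∷ xs) = begin
      filterᵇ p (reverse (x ∷ xs))
    ≡⟨ cong (filterᵇ p) (ListP.unfold-reverse x xs) ⟩
      filterᵇ p (reverse xs ++ [ x ])
    ≡⟨ ListP.filter-++ (T? ∘ p) (reverse xs) [ x ] ⟩
      filterᵇ p (reverse xs) ++ filterᵇ p [ x ]
    ≡⟨ cong (_++ filterᵇ p [ x ]) (filterᵇ-reverse p xs) ⟩
      reverse (filterᵇ p xs) ++ filterᵇ p [ x ]
    ≡⟨ last-step ⟩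
      reverse (filterᵇ p (x ∷ xs)) ∎
    where
      last-step : reverse (filterᵇ p xs) ++ filterᵇ p [ x ] ≡ reverse (filterᵇ p (x ∷ xs))
      last-step with p x
      ... | true  = sym (ListP.unfold-reverse x (filterᵇ p xs))
      ... | false = ListP.++-identityʳ _

  filterᵇ-cong : {p q : A → Bool} → (∀ x → p x ≡ q x) → (xs : List A) → filterᵇ p xs ≡ filterᵇ q xs
  filterᵇ-cong p≡q [] = refl
  filterᵇ-cong {p} {q} p≡q (x ∷ xs) with p x | q x | p≡q x
  ... | true  | .true  | refl = cong (x ∷_) (filterᵇ-cong p≡q xs)
  ... | false | .false | refl = filterᵇ-cong p≡q xs

  applyUpTo-+ : (f : ℕ → A) (m n : ℕ) →
    applyUpTo f (m + n) ≡ applyUpTo f m ++ applyUpTo (λ i → f (m + i)) n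
  applyUpTo-+ f zero n = refl
  applyUpTo-+ f (suc m) n = cong (f 0 ∷_) (applyUpTo-+ (f ∘ suc) m n)

  all-replicate : (x : A) (xs : List A) → All (_≡ x) xs → xs ≡ replicate (length xs) x
  all-replicate x [] [] = refl
  all-replicate x (_ ∷ xs) (refl ∷ xs≡x) = cong (x ∷_) (all-replicate x xs xs≡x)

  concat-indicator : (xs : List A) {m n : ℕ} → m < n →
    concat (applyUpTo (λ j → if m ℕ.≡ᵇ j then xs else []) n) ≡ xs
  concat-indicator xs {zero} {suc n} _ = begin
      xs ++ concat (applyUpTo (λ _ → []) n)
    ≡⟨ cong (λ ys → xs ++ concat ys) (sym (ListP.map-upTo (λ _ → []) n)) ⟩
      xs ++ concatMap (λ _ → []) (upTo n)
    ≡⟨ cong (xs ++_) (concatMap-[] (upTo n)) ⟩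
      xs ++ []
    ≡⟨ ListP.++-identityʳ xs ⟩
      xs ∎
  concat-indicator xs {suc m} {suc n} (s≤s m<n) = concat-indicator xs m<n

⌊+≟+⌋ : ∀ m j → ⌊ + m ℤ.≟ + j ⌋ ≡ (m ℕ.≡ᵇ j)
⌊+≟+⌋ m j = trans (isYes≗does (+ m ℤ.≟ + j))
  (does-⇔ (mk⇔ (ℕP.≡⇒≡ᵇ m j ∘ ℤP.+-injective) (cong +_ ∘ ℕP.≡ᵇ⇒≡ m j)) (+ m ℤ.≟ + j) (T? (m ℕ.≡ᵇ j)))

⌊-≟-⌋ : ∀ v w → ⌊ ℤ.- v ℤ.≟ ℤ.- w ⌋ ≡ ⌊ v ℤ.≟ w ⌋
⌊-≟-⌋ v w = trans (isYes≗does (ℤ.- v ℤ.≟ ℤ.- w))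
  (trans (does-⇔ (mk⇔ ℤP.neg-injective (cong (λ t → ℤ.- t))) (ℤ.- v ℤ.≟ ℤ.- w) (v ℤ.≟ w)) (sym (isYes≗does (v ℤ.≟ w))))

neg-nonneg≢pos : ∀ {v} n → 0ℤ ℤ.≤ v → ℤ.- v ≢ + suc n
neg-nonneg≢pos {v} n 0≤v -v≡n = negative (trans (sym (ℤP.neg-involutive v)) (cong (λ t → ℤ.- t) -v≡n)) 0≤v
  where
    negative : v ≡ ℤ.-[1+ n ] → ¬ (0ℤ ℤ.≤ v)
    negative refl ()

memℤ-true : ∀ {v} l → v ∈ l → memℤ v l ≡ true
memℤ-true {v} (x ∷ l) v∈ with v ℤ.≟ x
... | yes _ = refl
memℤ-true (x ∷ l) (here refl) | no v≢x = ⊥-elim (v≢x refl)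
memℤ-true (x ∷ l) (there v∈) | no _ = memℤ-true l v∈

memℤ-false : ∀ {v} l → ¬ v ∈ l → memℤ v l ≡ false
memℤ-false [] _ = refl
memℤ-false {v} (x ∷ l) v∉ with v ℤ.≟ x
... | yes refl = ⊥-elim (v∉ (here refl))
... | no _ = memℤ-false l (v∉ ∘ there)

-- Buckets: sorting the elements of a list by an integer key.

module _ {A : Set} (key : A → ℤ) where

  bucket : ℤ → List A → List A
  bucket j = filterᵇ (λ e → ⌊ key e ℤ.≟ j ⌋)

  private
    inBucket? : (j : ℤ) → Decidable (λ e → T ⌊ key e ℤ.≟ j ⌋)
    inBucket? j = T? ∘ λ e → ⌊ key e ℤ.≟ j ⌋

    skip : ∀ {e L j} → key e ≢ j → bucket j (e ∷ L) ≡ bucket j L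
    skip {j = j} e≢j = ListP.filter-reject (inBucket? j) (e≢j ∘ toWitness)

  DistinctKeys : List A → Set
  DistinctKeys = AllPairs (λ e e' → key e ≢ key e')

  bucket⁺ : ∀ {e L j} → e ∈ L → key e ≡ j → e ∈ bucket j L
  bucket⁺ {j = j} e∈L key≡j = ∈P.∈-filter⁺ (inBucket? j) e∈L (fromWitness key≡j)

  bucket⁻ : ∀ {e L j} → e ∈ bucket j L → e ∈ L × key e ≡ j
  bucket⁻ {j = j} e∈ = let e∈L , inside = ∈P.∈-filter⁻ (inBucket? j) e∈ in e∈L , toWitness inside

  data BucketView (L : List A) (j : ℤ) : Set where
    empty     : bucket j L ≡ [] → BucketView L j
    singleton : (e : A) → e ∈ L → key e ≡ j → bucket j L ≡ [ e ] → BucketView L j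

  bucketView : {L : List A} → DistinctKeys L → (j : ℤ) → BucketView L j
  bucketView [] j = empty refl
  bucketView {e ∷ L} (e≢L ∷ distinct) j with key e ℤ.≟ j
  ... | yes e≡j = singleton e (here refl) e≡j
        (trans (ListP.filter-accept (inBucket? j) (fromWitness e≡j)) (cong (e ∷_) rest-empty))
    where
      rest-empty : bucket j L ≡ []
      rest-empty = ListP.filter-none (inBucket? j)
                     (All.map (λ e≢e' e'≡j → e≢e' (trans e≡j (sym (toWitness e'≡j)))) e≢L)
  ... | no e≢j with bucketView distinct j
  ...   | empty b≡[] = empty (trans (skip e≢j) b≡[])
  ...   | singleton e' e'∈L e'≡j b≡[e'] = singleton e' (there e'∈L) e'≡j (trans (skip e≢j) b≡[e'])

  -- Hence reversing (the image of) a bucket changes nothing.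
  bucket-reverse : {B : Set} (f : A → B) {L : List A} → DistinctKeys L → (j : ℤ) →
    reverse (map f (bucket j L)) ≡ map f (bucket j L)
  bucket-reverse f distinct j with bucketView distinct j
  ... | empty b≡[] rewrite b≡[] = refl
  ... | singleton e _ _ b≡[e] rewrite b≡[e] = refl

count-++ : (p : Step → Bool) (u v : List Step) → count p (u ++ v) ≡ count p u + count p v
count-++ p u v = trans (cong length (ListP.filter-++ (T? ∘ p) u v)) (ListP.length-++ (filterᵇ p u))

length-count : ∀ w → length w ≡ count isN w + count isE w
length-count [] = refl
length-count (N ∷ w) = cong suc (length-count w)
length-count (E ∷ w) = trans (cong suc (length-count w)) (sym (ℕP.+-suc (count isN w) (count isE w)))

count-north-replicate : ∀ k → count isN (replicate k N) ≡ k
count-north-replicate zero = refl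
count-north-replicate (suc k) = cong suc (count-north-replicate k)

count-east-replicate : ∀ k → count isE (replicate k N) ≡ 0
count-east-replicate zero = refl
count-east-replicate (suc k) = count-east-replicate k

count-concatMap-++ : {A : Set} (p : Step → Bool) (f g : A → List Step) (xs : List A) →
  count p (concatMap (λ x → f x ++ g x) xs) ≡ count p (concatMap f xs) + count p (concatMap g xs)
count-concatMap-++ p f g [] = refl
count-concatMap-++ p f g (x ∷ xs) = begin
    count p ((f x ++ g x) ++ concatMap (λ x → f x ++ g x) xs)
  ≡⟨ count-++ p (f x ++ g x) _ ⟩
    count p (f x ++ g x) + count p (concatMap (λ x → f x ++ g x) xs)
  ≡⟨ cong₂ _+_ (count-++ p (f x) (g x)) (count-concatMap-++ p f g xs) ⟩
    (count p (f x) + count p (g x)) + (count p (concatMap f xs) + count p (concatMap g xs))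
  ≡⟨ interchange (count p (f x)) (count p (g x)) _ _ ⟩
    (count p (f x) + count p (concatMap f xs)) + (count p (g x) + count p (concatMap g xs))
  ≡⟨ sym (cong₂ _+_ (count-++ p (f x) (concatMap f xs)) (count-++ p (g x) (concatMap g xs))) ⟩
    count p (concatMap f (x ∷ xs)) + count p (concatMap g (x ∷ xs)) ∎

count-buckets : {A : Set} (key : A → ℤ) (p : Step → Bool) (f : A → Step) (n : ℕ) (L : List A) →
  All (λ e → ∃[ m ] (m < n × key e ≡ + m)) L →
  count p (concatMap (λ j → map f (bucket key (+ j) L)) (upTo n)) ≡ count p (map f L)
count-buckets key p f n [] [] = cong (count p) (concatMap-[] (upTo n))
count-buckets {A} key p f n (e ∷ L) ((m , m<n , key≡m) ∷ keys) = begin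
    count p (concatMap (λ j → map f (bucket key (+ j) (e ∷ L))) (upTo n))
  ≡⟨ cong (count p) (ListP.concatMap-cong (λ j → map-filterᵇ-∷ (inBucket j) f e L) (upTo n)) ⟩
    count p (concatMap (λ j → hit j ++ map f (bucket key (+ j) L)) (upTo n))
  ≡⟨ count-concatMap-++ p hit (λ j → map f (bucket key (+ j) L)) (upTo n) ⟩
    count p (concatMap hit (upTo n)) + count p (concatMap (λ j → map f (bucket key (+ j) L)) (upTo n))
  ≡⟨ cong₂ _+_ (cong (count p) only-bucket-m) (count-buckets key p f n L keys) ⟩
    count p [ f e ] + count p (map f L)
  ≡⟨ sym (count-++ p [ f e ] (map f L)) ⟩
    count p (map f (e ∷ L)) ∎
  where
    inBucket : ℕ → A → Bool
    inBucket j e = ⌊ key e ℤ.≟ + j ⌋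
    hit : ℕ → List Step
    hit j = if inBucket j e then [ f e ] else []
    only-bucket-m : concatMap hit (upTo n) ≡ [ f e ]
    only-bucket-m = begin
        concatMap hit (upTo n)
      ≡⟨ ListP.concatMap-cong (λ j → cong (λ t → if t then [ f e ] else [])
           (trans (cong (λ k → ⌊ k ℤ.≟ + j ⌋) key≡m) (⌊+≟+⌋ m j))) (upTo n) ⟩
        concatMap (λ j → if m ℕ.≡ᵇ j then [ f e ] else []) (upTo n)
      ≡⟨ cong concat (ListP.map-upTo _ n) ⟩
        concat (applyUpTo (λ j → if m ℕ.≡ᵇ j then [ f e ] else []) n)
      ≡⟨ concat-indicator [ f e ] m<n ⟩
        [ f e ] ∎

steps : ℕ × ℕ → List Step → List ((ℕ × ℕ) × Step)
steps p [] = []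
steps p (s ∷ w) = (p , s) ∷ steps (move p s) w

steps-starts : ∀ p w → map proj₁ (steps p w) ≡ starts p w
steps-starts p [] = refl
steps-starts p (s ∷ w) = cong (p ∷_) (steps-starts (move p s) w)

steps-word : ∀ p w → map proj₂ (steps p w) ≡ w
steps-word p [] = refl
steps-word p (s ∷ w) = cong (s ∷_) (steps-word (move p s) w)

origin-visited : ∀ p w → p ∈ visited p w
origin-visited p [] = here refl
origin-visited p (s ∷ w) = here refl

step-visited : ∀ p w {q s} → (q , s) ∈ steps p w → q ∈ visited p w × move q s ∈ visited p w
step-visited p (s ∷ w) (here refl) = here refl , there (origin-visited (move p s) w)
step-visited p (s ∷ w) (there e∈) =
  let q∈ , q'∈ = step-visited (move p s) w e∈ in there q∈ , there q'∈

visited-bounds : ∀ x₀ y₀ w {x y} → (x , y) ∈ visited (x₀ , y₀) w →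
  (x₀ ≤ x × x ≤ x₀ + count isE w) × (y₀ ≤ y × y ≤ y₀ + count isN w)
visited-bounds x₀ y₀ [] (here refl) = (ℕP.≤-refl , ℕP.m≤m+n x₀ 0) , (ℕP.≤-refl , ℕP.m≤m+n y₀ 0)
visited-bounds x₀ y₀ (s ∷ w) (here refl) = (ℕP.≤-refl , ℕP.m≤m+n x₀ _) , (ℕP.≤-refl , ℕP.m≤m+n y₀ _)
visited-bounds x₀ y₀ (N ∷ w) {x} {y} (there q∈) with visited-bounds x₀ (suc y₀) w q∈
... | x-bounds , (y₀<y , y≤) = x-bounds , (ℕP.≤-trans (ℕP.n≤1+n y₀) y₀<y , subst (y ≤_) (sym (ℕP.+-suc y₀ _)) y≤)
visited-bounds x₀ y₀ (E ∷ w) {x} {y} (there q∈) with visited-bounds (suc x₀) y₀ w q∈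
... | (x₀<x , x≤) , y-bounds = (ℕP.≤-trans (ℕP.n≤1+n x₀) x₀<x , subst (x ≤_) (sym (ℕP.+-suc x₀ _)) x≤) , y-bounds

endpoint : ℕ × ℕ → List Step → ℕ × ℕ
endpoint p [] = p
endpoint p (s ∷ w) = endpoint (move p s) w

endpoint-coords : ∀ x₀ y₀ w → endpoint (x₀ , y₀) w ≡ (x₀ + count isE w , y₀ + count isN w)
endpoint-coords x₀ y₀ [] = cong₂ _,_ (sym (ℕP.+-identityʳ x₀)) (sym (ℕP.+-identityʳ y₀))
endpoint-coords x₀ y₀ (N ∷ w) =
  trans (endpoint-coords x₀ (suc y₀) w) (cong (x₀ + count isE w ,_) (sym (ℕP.+-suc y₀ _)))
endpoint-coords x₀ y₀ (E ∷ w) =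
  trans (endpoint-coords (suc x₀) y₀ w) (cong (_, y₀ + count isN w) (sym (ℕP.+-suc x₀ _)))

-- Where the north step c of the row lies relative to a step s starting at abscissa x:
-- at x for a north step, strictly east of x for an east step.
RowNorth : Step → ℕ → ℕ → Set
RowNorth N x c = c ≡ x
RowNorth E x c = x < c

RowNorth-suc : ∀ s x c → RowNorth s x c → RowNorth s (suc x) (suc c)
RowNorth-suc N x c c≡x = cong suc c≡x
RowNorth-suc E x c x<c = s≤s x<c

step-row : ∀ x₀ y₀ w {q s} → (q , s) ∈ steps (x₀ , y₀) w →
  ∃[ dx ] ∃[ dy ] (q ≡ (x₀ + dx , y₀ + dy) × RowNorth s dx (eastBeforeN w dy))
step-row x₀ y₀ (N ∷ w) (here refl) = 0 , 0 , sym (cong₂ _,_ (ℕP.+-identityʳ x₀) (ℕP.+-identityʳ y₀)) , refl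
step-row x₀ y₀ (E ∷ w) (here refl) = 0 , 0 , sym (cong₂ _,_ (ℕP.+-identityʳ x₀) (ℕP.+-identityʳ y₀)) , s≤s ℕ.z≤n
step-row x₀ y₀ (N ∷ w) (there e∈) with step-row x₀ (suc y₀) w e∈
... | dx , dy , q≡ , row = dx , suc dy , trans q≡ (cong (x₀ + dx ,_) (sym (ℕP.+-suc y₀ dy))) , row
step-row x₀ y₀ (E ∷ w) {s = s} (there e∈) with step-row (suc x₀) y₀ w e∈
... | dx , dy , q≡ , row =
  suc dx , dy , trans q≡ (cong (_, y₀ + dy) (sym (ℕP.+-suc x₀ dx))) , RowNorth-suc s dx _ row

-- Levels of lattice points.

nonneg-difference : ∀ {m n} → 0ℤ ℤ.≤ + m ℤ.- + n → n ≤ m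
nonneg-difference 0≤m-n = ℤP.drop‿+≤+ (ℤP.0≤i-j⇒j≤i 0≤m-n)

module Levels (a b : ℕ) where

  level-move : ∀ q s → level a b (move q s) ≡ level a b q ℤ.+ stepVal a b s
  level-move (x , y) N rewrite ℕP.*-suc b y = north (+ b) (+ (b * y)) (+ (a * x))
    where
      north : ∀ (B Y X : ℤ) → (B ℤ.+ Y) ℤ.- X ≡ (Y ℤ.- X) ℤ.+ B
      north = solve-∀
  level-move (x , y) E rewrite ℕP.*-suc a x = east (+ a) (+ (a * x)) (+ (b * y))
    where
      east : ∀ (A X Y : ℤ) → Y ℤ.- (A ℤ.+ X) ≡ (Y ℤ.- X) ℤ.+ ℤ.- A
      east = solve-∀

  level-nonneg : ∀ {x y} → 0ℤ ℤ.≤ level a b (x , y) → a * x ≤ b * y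
  level-nonneg = nonneg-difference

  level-ℕ : ∀ {x y} → a * x ≤ b * y → level a b (x , y) ≡ + (b * y ∸ a * x)
  level-ℕ {x} {y} ax≤by = trans (ℤP.[+m]-[+n]≡m⊖n (b * y) (a * x)) (ℤP.⊖-≥ ax≤by)

  level-cross : ∀ {x y x' y'} → level a b (x , y) ≡ level a b (x' , y') →
    b * y + a * x' ≡ b * y' + a * x
  level-cross {x} {y} {x'} {y'} eq = ℤP.+-injective (begin
      + (b * y) ℤ.+ + (a * x')
    ≡⟨ regroup (+ (b * y)) (+ (a * x)) (+ (a * x')) ⟩
      level a b (x , y) ℤ.+ (+ (a * x) ℤ.+ + (a * x'))
    ≡⟨ cong (ℤ._+ (+ (a * x) ℤ.+ + (a * x'))) eq ⟩
      level a b (x' , y') ℤ.+ (+ (a * x) ℤ.+ + (a * x'))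
    ≡⟨ cancel (+ (b * y')) (+ (a * x')) (+ (a * x)) ⟩
      + (b * y') ℤ.+ + (a * x) ∎)
    where
      regroup : ∀ (Y X X' : ℤ) → Y ℤ.+ X' ≡ (Y ℤ.- X) ℤ.+ (X ℤ.+ X')
      regroup = solve-∀
      cancel : ∀ (Y' X' X : ℤ) → (Y' ℤ.- X') ℤ.+ (X ℤ.+ X') ≡ Y' ℤ.+ X
      cancel = solve-∀

rows-up : ∀ a b x y d → b * y + (a * x + b * d) ≡ b * (y + d) + a * x
rows-up = ℕSolver.solve-∀

-- Injectivity of the level on the rectangle, which is where gcd(a,b) = 1 enters.
module CoprimeLevels (a b : ℕ) (a≥1 : 1 ≤ a) (cop : Coprime a b) where
  open Levels a b

  instance
    a≢0 : ℕ.NonZero a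
    a≢0 = ℕ.>-nonZero a≥1

  -- If a·x + b·d = a·x' with d ≤ a and x' ≤ b, then a ∣ d, so d = 0 (and x = x')
  -- or d = a (and x = 0, x' = b).
  shift-cases : ∀ d x x' → d ≤ a → x' ≤ b → a * x + b * d ≡ a * x' →
    (d ≡ 0 × x ≡ x') ⊎ (d ≡ a × x ≡ 0 × x' ≡ b)
  shift-cases zero x x' _ _ e =
    inj₁ (refl , ℕP.*-cancelˡ-≡ x x' a (trans (sym no-shift) e))
    where
      no-shift : a * x + b * 0 ≡ a * x
      no-shift = trans (cong (λ t → a * x + t) (ℕP.*-zeroʳ b)) (ℕP.+-identityʳ (a * x))
  shift-cases d@(suc _) x x' d≤a x'≤b e = inj₂ (d≡a , x≡0 , trans x'≡x+b (cong (_+ b) x≡0))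
    where
      a∣d : a ∣ d
      a∣d = coprime-divisor cop (∣m+n∣m⇒∣n (subst (a ∣_) (sym e) (m∣m*n x')) (m∣m*n x))
      d≡a : d ≡ a
      d≡a = ℕP.≤-antisym d≤a (∣⇒≤ a∣d)
      x'≡x+b : x' ≡ x + b
      x'≡x+b = ℕP.*-cancelˡ-≡ x' (x + b) a (begin
          a * x'         ≡⟨ sym e ⟩
          a * x + b * d  ≡⟨ cong (λ t → a * x + b * t) d≡a ⟩
          a * x + b * a  ≡⟨ cong (λ t → a * x + t) (ℕP.*-comm b a) ⟩
          a * x + a * b  ≡⟨ sym (ℕP.*-distribˡ-+ a x b) ⟩
          a * (x + b)    ∎)
      x≡0 : x ≡ 0
      x≡0 = ℕP.n≤0⇒n≡0 (ℕP.+-cancelʳ-≤ b x 0 (subst (_≤ b) x'≡x+b x'≤b))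

  level-injective-≤ : ∀ {x y x' y'} → x' ≤ b → y' ≤ a → y ≤ y' →
    level a b (x , y) ≡ level a b (x' , y') →
    (x ≡ x' × y ≡ y') ⊎ (x ≡ 0 × y ≡ 0 × x' ≡ b × y' ≡ a)
  level-injective-≤ {x} {y} {x'} x'≤b y'≤a y≤y' eq with ℕP.m≤n⇒∃[o]m+o≡n y≤y'
  ... | d , refl with shift-cases d x x' (ℕP.m+n≤o⇒n≤o y y'≤a) x'≤b shifted
    where
      shifted : a * x + b * d ≡ a * x'
      shifted = ℕP.+-cancelˡ-≡ (b * y) _ _ (trans (rows-up a b x y d) (sym (level-cross eq)))
  ... | inj₁ (refl , x≡x') = inj₁ (x≡x' , sym (ℕP.+-identityʳ y))
  ... | inj₂ (refl , refl , refl) = inj₂ (refl , y≡0 , refl , cong (_+ a) y≡0)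
    where
      y≡0 : y ≡ 0
      y≡0 = ℕP.n≤0⇒n≡0 (ℕP.+-cancelʳ-≤ a y 0 y'≤a)

  InRect : ℕ × ℕ → Set
  InRect (x , y) = x ≤ b × y ≤ a

  level-injective : ∀ {p q} → InRect p → InRect q → level a b p ≡ level a b q →
    p ≡ q ⊎ (p ≡ (0 , 0) × q ≡ (b , a)) ⊎ (p ≡ (b , a) × q ≡ (0 , 0))
  level-injective {x , y} {x' , y'} (x≤b , y≤a) (x'≤b , y'≤a) eq with ℕP.≤-total y y'
  ... | inj₁ y≤y' with level-injective-≤ x'≤b y'≤a y≤y' eq
  ...   | inj₁ (refl , refl) = inj₁ refl
  ...   | inj₂ (refl , refl , refl , refl) = inj₂ (inj₁ (refl , refl))
  level-injective {x , y} {x' , y'} (x≤b , y≤a) (x'≤b , y'≤a) eq | inj₂ y'≤y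
    with level-injective-≤ x≤b y≤a y'≤y (sym eq)
  ...   | inj₁ (refl , refl) = inj₁ refl
  ...   | inj₂ (refl , refl , refl , refl) = inj₂ (inj₂ (refl , refl))

  -- b·y = a·(x+1) has no solution with y < a: no north step starts at level a.
  no-north-at-level-a : ∀ x y → y < a → b * y ≢ a * suc x
  no-north-at-level-a x zero _ e =
    ℕP.<⇒≢ (ℕP.<-≤-trans a≥1 (ℕP.m≤m*n a (suc x))) (trans (sym (ℕP.*-zeroʳ b)) e)
  no-north-at-level-a x y@(suc _) y<a e =
    ℕP.<⇒≱ y<a (∣⇒≤ (coprime-divisor cop (divides (suc x) (trans e (ℕP.*-comm a (suc x))))))


  corner-starts-nothing : ∀ {q} s → q ≡ (b , a) → ¬ InRect (move q s)
  corner-starts-nothing N refl (_ , a<a) = ℕP.<-irrefl refl a<a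
  corner-starts-nothing E refl (b<b , _) = ℕP.<-irrefl refl b<b

  start-levels-distinct : ∀ p w → (∀ {q} → q ∈ visited p w → InRect q) →
    DistinctKeys (level a b ∘ proj₁) (steps p w)
  start-levels-distinct p [] _ = []
  start-levels-distinct (x , y) (s ∷ w) in-rect =
    All.tabulate first-differs ∷ start-levels-distinct (move (x , y) s) w (in-rect ∘ there)
    where
      not-revisited : ∀ s → ¬ ((x , y) ∈ visited (move (x , y) s) w)
      not-revisited N q∈ = ℕP.<-irrefl refl (proj₁ (proj₂ (visited-bounds x (suc y) w q∈)))
      not-revisited E q∈ = ℕP.<-irrefl refl (proj₁ (proj₁ (visited-bounds (suc x) y w q∈)))

      first-differs : ∀ {e} → e ∈ steps (move (x , y) s) w → level a b (x , y) ≢ level a b (proj₁ e)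
      first-differs {q , s'} e∈ eq
        with level-injective (in-rect (here refl)) (in-rect (there (proj₁ (step-visited (move (x , y) s) w e∈)))) eq
      ... | inj₁ refl = not-revisited s (proj₁ (step-visited (move (x , y) s) w e∈))
      ... | inj₂ (inj₁ (_ , q≡ba)) =
        corner-starts-nothing s' q≡ba (in-rect (there (proj₂ (step-visited (move (x , y) s) w e∈))))
      ... | inj₂ (inj₂ (p≡ba , _)) =
        corner-starts-nothing s p≡ba (in-rect (there (origin-visited (move (x , y) s) w)))

module Labels (a b : ℕ) where
  open Levels a b

  finalLabel : ℤ → List Step → ℤ
  finalLabel l [] = l
  finalLabel l (s ∷ u) = finalLabel (l ℤ.+ stepVal a b s) u

  finalLabel-++ : ∀ l u v → finalLabel l (u ++ v) ≡ finalLabel (finalLabel l u) v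
  finalLabel-++ l [] v = refl
  finalLabel-++ l (s ∷ u) v = finalLabel-++ (l ℤ.+ stepVal a b s) u v

  labelled-++ : ∀ l u v → labelled a b l (u ++ v) ≡ labelled a b l u ++ labelled a b (finalLabel l u) v
  labelled-++ l [] v = refl
  labelled-++ l (s ∷ u) v = cong (_ ∷_) (labelled-++ (l ℤ.+ stepVal a b s) u v)

  finalLabel-reverse : ∀ w p l → finalLabel l (reverse w) ≡ l ℤ.+ (level a b (endpoint p w) ℤ.- level a b p)
  finalLabel-reverse [] p l = sym (no-change l (level a b p))
    where
      no-change : ∀ (l L : ℤ) → l ℤ.+ (L ℤ.- L) ≡ l
      no-change = solve-∀
  finalLabel-reverse (s ∷ w) p l = begin
      finalLabel l (reverse (s ∷ w))
    ≡⟨ cong (finalLabel l) (ListP.unfold-reverse s w) ⟩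
      finalLabel l (reverse w ++ [ s ])
    ≡⟨ finalLabel-++ l (reverse w) [ s ] ⟩
      finalLabel l (reverse w) ℤ.+ stepVal a b s
    ≡⟨ cong (ℤ._+ stepVal a b s) (finalLabel-reverse w (move p s) l) ⟩
      (l ℤ.+ (end ℤ.- level a b (move p s))) ℤ.+ stepVal a b s
    ≡⟨ cong (λ t → (l ℤ.+ (end ℤ.- t)) ℤ.+ stepVal a b s) (level-move p s) ⟩
      (l ℤ.+ (end ℤ.- (level a b p ℤ.+ stepVal a b s))) ℤ.+ stepVal a b s
    ≡⟨ telescope l end (level a b p) (stepVal a b s) ⟩
      l ℤ.+ (end ℤ.- level a b p) ∎
    where
      end : ℤ
      end = level a b (endpoint p (s ∷ w))
      telescope : ∀ (l E L S : ℤ) → (l ℤ.+ (E ℤ.- (L ℤ.+ S))) ℤ.+ S ≡ l ℤ.+ (E ℤ.- L)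
      telescope = solve-∀

  -- The label attached to a step of the reversed path: l plus the level of the end of the
  -- path minus the level at which the step starts.
  relabel : ℤ → ℤ → (ℕ × ℕ) × Step → ℤ × Step
  relabel l end (q , s) = (l ℤ.+ (end ℤ.- level a b q) , s)

  labelled-reverse : ∀ w p l →
    labelled a b l (reverse w) ≡ reverse (map (relabel l (level a b (endpoint p w))) (steps p w))
  labelled-reverse [] p l = refl
  labelled-reverse (s ∷ w) p l = begin
      labelled a b l (reverse (s ∷ w))
    ≡⟨ cong (labelled a b l) (ListP.unfold-reverse s w) ⟩
      labelled a b l (reverse w ++ [ s ])
    ≡⟨ labelled-++ l (reverse w) [ s ] ⟩
      labelled a b l (reverse w) ++ [ (finalLabel l (reverse w) ℤ.+ stepVal a b s , s) ]
    ≡⟨ cong₂ _++_ (labelled-reverse w (move p s) l) (cong (λ t → [ (t , s) ]) last-label) ⟩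
      reverse (map R (steps (move p s) w)) ++ [ R (p , s) ]
    ≡⟨ sym (ListP.unfold-reverse (R (p , s)) (map R (steps (move p s) w))) ⟩
      reverse (map R (steps p (s ∷ w))) ∎
    where
      R : (ℕ × ℕ) × Step → ℤ × Step
      R = relabel l (level a b (endpoint p (s ∷ w)))
      last-label : finalLabel l (reverse w) ℤ.+ stepVal a b s ≡ proj₁ (R (p , s))
      last-label = begin
          finalLabel l (reverse w) ℤ.+ stepVal a b s
        ≡⟨ sym (finalLabel-++ l (reverse w) [ s ]) ⟩
          finalLabel l (reverse w ++ [ s ])
        ≡⟨ cong (finalLabel l) (sym (ListP.unfold-reverse s w)) ⟩
          finalLabel l (reverse (s ∷ w))
        ≡⟨ finalLabel-reverse (s ∷ w) p l ⟩
          proj₁ (R (p , s)) ∎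

-- Words of partitions.

replicate-∷ : {A : Set} (r : ℕ) (x : A) (u : List A) → replicate r x ++ x ∷ u ≡ x ∷ (replicate r x ++ u)
replicate-∷ zero x u = refl
replicate-∷ (suc r) x u = cong (x ∷_) (replicate-∷ r x u)

pathFrom-zeros : ∀ b r parts → pathFrom b 0 (replicate r 0 ++ parts) ≡ replicate r N ++ pathFrom b 0 parts
pathFrom-zeros b zero parts = refl
pathFrom-zeros b (suc r) parts = cong (N ∷_) (pathFrom-zeros b r parts)

pathFrom-eBeforeEachN : ∀ b c d u → d ≤ c → count isE u + c ≡ b →
  pathFrom b d (eBeforeEachN c u) ≡ replicate (c ∸ d) E ++ u
pathFrom-eBeforeEachN b c d [] d≤c #E≡b =
  trans (cong (λ t → replicate (t ∸ d) E) (sym #E≡b)) (sym (ListP.++-identityʳ _))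
pathFrom-eBeforeEachN b c d (N ∷ u) d≤c #E≡b = cong (λ t → replicate (c ∸ d) E ++ N ∷ t) (begin
    pathFrom b c (eBeforeEachN c u)
  ≡⟨ pathFrom-eBeforeEachN b c c u ℕP.≤-refl #E≡b ⟩
    replicate (c ∸ c) E ++ u
  ≡⟨ cong (λ t → replicate t E ++ u) (ℕP.n∸n≡0 c) ⟩
    u ∎)
pathFrom-eBeforeEachN b c d (E ∷ u) d≤c #E≡b = begin
    pathFrom b d (eBeforeEachN (suc c) u)
  ≡⟨ pathFrom-eBeforeEachN b (suc c) d u (ℕP.m≤n⇒m≤1+n d≤c) (trans (ℕP.+-suc (count isE u) c) #E≡b) ⟩
    replicate (suc c ∸ d) E ++ u
  ≡⟨ cong (λ t → replicate t E ++ u) (ℕP.+-∸-assoc 1 d≤c) ⟩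
    E ∷ (replicate (c ∸ d) E ++ u)
  ≡⟨ sym (replicate-∷ (c ∸ d) E u) ⟩
    replicate (c ∸ d) E ++ E ∷ u ∎

positiveParts : List Step → List ℕ
positiveParts y = filterᵇ (λ p → 0 ℕ.<ᵇ p) (eBeforeEachN 0 y)

eBeforeEachN-positive : ∀ c u → filterᵇ (λ p → 0 ℕ.<ᵇ p) (eBeforeEachN (suc c) u) ≡ eBeforeEachN (suc c) u
eBeforeEachN-positive c [] = refl
eBeforeEachN-positive c (N ∷ u) = cong (suc c ∷_) (eBeforeEachN-positive c u)
eBeforeEachN-positive c (E ∷ u) = eBeforeEachN-positive (suc c) u

length-eBeforeEachN : ∀ c u → length (eBeforeEachN c u) ≡ count isN u
length-eBeforeEachN c [] = refl
length-eBeforeEachN c (N ∷ u) = cong suc (length-eBeforeEachN c u)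
length-eBeforeEachN c (E ∷ u) = length-eBeforeEachN (suc c) u

pathFrom-positiveParts : ∀ a b k y → count isN y + k ≡ a → count isE y ≡ b →
  pathFrom b 0 (replicate (a ∸ length (positiveParts y)) 0 ++ positiveParts y) ≡ replicate k N ++ y
pathFrom-positiveParts a b k [] #N≡ #E≡ = begin
    pathFrom b 0 (replicate a 0 ++ [])
  ≡⟨ pathFrom-zeros b a [] ⟩
    replicate a N ++ replicate b E
  ≡⟨ cong₂ (λ s t → replicate s N ++ replicate t E) (sym #N≡) (sym #E≡) ⟩
    replicate k N ++ [] ∎
pathFrom-positiveParts a b k (N ∷ y) #N≡ #E≡ =
  trans (pathFrom-positiveParts a b (suc k) y (trans (ℕP.+-suc (count isN y) k) #N≡) #E≡)
        (sym (replicate-∷ k N y))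
pathFrom-positiveParts a b k (E ∷ y) #N≡ #E≡ = begin
    pathFrom b 0 (replicate (a ∸ length (positiveParts (E ∷ y))) 0 ++ positiveParts (E ∷ y))
  ≡⟨ cong (λ ps → pathFrom b 0 (replicate (a ∸ length ps) 0 ++ ps)) (eBeforeEachN-positive 0 y) ⟩
    pathFrom b 0 (replicate (a ∸ length (eBeforeEachN 1 y)) 0 ++ eBeforeEachN 1 y)
  ≡⟨ cong (λ t → pathFrom b 0 (replicate (a ∸ t) 0 ++ eBeforeEachN 1 y)) (length-eBeforeEachN 1 y) ⟩
    pathFrom b 0 (replicate (a ∸ count isN y) 0 ++ eBeforeEachN 1 y)
  ≡⟨ cong (λ t → pathFrom b 0 (replicate t 0 ++ eBeforeEachN 1 y)) zeros ⟩
    pathFrom b 0 (replicate k 0 ++ eBeforeEachN 1 y)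
  ≡⟨ pathFrom-zeros b k (eBeforeEachN 1 y) ⟩
    replicate k N ++ pathFrom b 0 (eBeforeEachN 1 y)
  ≡⟨ cong (replicate k N ++_) (pathFrom-eBeforeEachN b 1 0 y ℕ.z≤n (trans (ℕP.+-comm (count isE y) 1) #E≡)) ⟩
    replicate k N ++ E ∷ y ∎
  where
    zeros : a ∸ count isN y ≡ k
    zeros = trans (cong (_∸ count isN y) (sym #N≡)) (ℕP.m+n∸m≡n (count isN y) k)

-- The same statement for wordPart, which lists the parts in decreasing order.
wordPart-positiveParts : ∀ a b k y → count isN y + k ≡ a → count isE y ≡ b →
  wordPart a b (reverse (positiveParts y)) ≡ replicate k N ++ y
wordPart-positiveParts a b k y #N≡ #E≡ = trans
  (cong₂ (λ s t → pathFrom b 0 (replicate (a ∸ s) 0 ++ t))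
         (ListP.length-reverse (positiveParts y)) (ListP.reverse-involutive (positiveParts y)))
  (pathFrom-positiveParts a b k y #N≡ #E≡)

-- Squares southeast of a path and the set Δ^c.

module Squares (a b : ℕ) (w : List Step) where

  row : ℕ → List (ℕ × ℕ)
  row y = filterᵇ (λ c → eastBeforeN w y ℕ.<ᵇ proj₁ c) (map (λ x → (suc x , y)) (upTo b))

  square⁺ : ∀ {x y} → y < a → x < b → eastBeforeN w y < suc x → (suc x , y) ∈ squaresSE a b w
  square⁺ {x} {y} y<a x<b east = ∈P.∈-concatMap⁺ row (Any.map (λ { refl → in-row }) (∈P.∈-upTo⁺ y<a))
    where
      in-row : (suc x , y) ∈ row y
      in-row = ∈P.∈-filter⁺ (T? ∘ λ c → eastBeforeN w y ℕ.<ᵇ proj₁ c)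
                 (∈P.∈-map⁺ (λ x → (suc x , y)) (∈P.∈-upTo⁺ x<b)) (ℕP.<⇒<ᵇ east)

  square⁻ : ∀ {c} → c ∈ squaresSE a b w →
    ∃[ x ] ∃[ y ] (c ≡ (suc x , y) × y < a × x < b × eastBeforeN w y < suc x)
  square⁻ c∈ with find (∈P.∈-concatMap⁻ row {xs = upTo a} c∈)
  ... | y , y∈ , c∈row
    with ∈P.∈-filter⁻ (T? ∘ λ c → eastBeforeN w y ℕ.<ᵇ proj₁ c) {xs = map (λ x → (suc x , y)) (upTo b)} c∈row
  ... | c∈map , east with ∈P.∈-map⁻ (λ x → (suc x , y)) {xs = upTo b} c∈map
  ... | x , x∈ , refl = x , y , refl , ∈P.∈-upTo⁻ y∈ , ∈P.∈-upTo⁻ x∈ , ℕP.<ᵇ⇒< _ _ east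

  deltaC⁺ : ∀ {c} → c ∈ squaresSE a b w → 0ℤ ℤ.≤ level a b c → level a b c ∈ deltaC a b w
  deltaC⁺ c∈ 0≤ = ∈P.∈-map⁺ (level a b) (∈P.∈-filter⁺ (T? ∘ λ c → 0ℤ ℤ.≤ᵇ level a b c) c∈ (ℤP.≤⇒≤ᵇ 0≤))

  deltaC⁻ : ∀ {v} → v ∈ deltaC a b w → ∃[ c ] (c ∈ squaresSE a b w × v ≡ level a b c)
  deltaC⁻ v∈ with ∈P.∈-map⁻ (level a b) v∈
  ... | c , c∈ , v≡ = c , proj₁ (∈P.∈-filter⁻ (T? ∘ λ c → 0ℤ ℤ.≤ᵇ level a b c) c∈) , v≡

module DyckPath (a b : ℕ) (a≥1 : 1 ≤ a) (b≥1 : 1 ≤ b) (cop : Coprime a b)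
                (π : List Step) (π∈D : InD a b π) where
  open Levels a b
  open CoprimeLevels a b a≥1 cop
  open Labels a b
  open Squares a b π

  instance
    b≢0 : ℕ.NonZero b
    b≢0 = ℕ.>-nonZero b≥1

  lv : ℕ × ℕ → ℤ
  lv = level a b

  #N≡a : count isN π ≡ a
  #N≡a = proj₁ π∈D

  #E≡b : count isE π ≡ b
  #E≡b = proj₁ (proj₂ π∈D)

  P : List ((ℕ × ℕ) × Step)
  P = steps (0 , 0) π

  startLevel : (ℕ × ℕ) × Step → ℤ
  startLevel = lv ∘ proj₁

  visited-in-rect : ∀ {q} → q ∈ visited (0 , 0) π → InRect q
  visited-in-rect {x , y} q∈ with visited-bounds 0 0 π q∈
  ... | (_ , x≤) , (_ , y≤) = subst (x ≤_) #E≡b x≤ , subst (y ≤_) #N≡a y≤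

  visited-nonneg : ∀ {q} → q ∈ visited (0 , 0) π → 0ℤ ℤ.≤ lv q
  visited-nonneg = All.lookup (proj₂ (proj₂ π∈D))

  visited-level : ∀ {x y} → (x , y) ∈ visited (0 , 0) π → lv (x , y) ≡ + (b * y ∸ a * x)
  visited-level q∈ = level-ℕ (level-nonneg (visited-nonneg q∈))

  visited-level-bound : ∀ {x y} → (x , y) ∈ visited (0 , 0) π → b * y ∸ a * x ≤ a * b
  visited-level-bound {x} {y} q∈ = ℕP.≤-trans (ℕP.m∸n≤m (b * y) (a * x))
    (ℕP.≤-trans (ℕP.*-monoʳ-≤ b (proj₂ (visited-in-rect q∈))) (ℕP.≤-reflexive (ℕP.*-comm b a)))

  endpoint-level : lv (endpoint (0 , 0) π) ≡ 0ℤ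
  endpoint-level = begin
      lv (endpoint (0 , 0) π)
    ≡⟨ cong lv (endpoint-coords 0 0 π) ⟩
      lv (count isE π , count isN π)
    ≡⟨ cong₂ (λ x y → lv (x , y)) #E≡b #N≡a ⟩
      + (b * a) ℤ.- + (a * b)
    ≡⟨ cong (λ t → + t ℤ.- + (a * b)) (ℕP.*-comm b a) ⟩
      + (a * b) ℤ.- + (a * b)
    ≡⟨ ℤP.+-inverseʳ (+ (a * b)) ⟩
      0ℤ ∎

  distinct : DistinctKeys startLevel P
  distinct = start-levels-distinct (0 , 0) π visited-in-rect

  S : ℕ → List Step
  S j = map proj₂ (bucket startLevel (+ j) P)

  negated : (ℕ × ℕ) × Step → ℤ × Step
  negated (q , s) = (ℤ.- lv q , s)

  labels-rev-π : labelled a b 0ℤ (reverse π) ≡ reverse (map negated P)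
  labels-rev-π = trans (labelled-reverse π (0 , 0) 0ℤ) (cong reverse (ListP.map-cong relabel≗ P))
    where
      relabel≗ : ∀ e → relabel 0ℤ (lv (endpoint (0 , 0) π)) e ≡ negated e
      relabel≗ (q , s) = cong (_, s) (begin
          0ℤ ℤ.+ (lv (endpoint (0 , 0) π) ℤ.- lv q)
        ≡⟨ cong (λ t → 0ℤ ℤ.+ (t ℤ.- lv q)) endpoint-level ⟩
          0ℤ ℤ.+ (0ℤ ℤ.- lv q)
        ≡⟨ trans (ℤP.+-identityˡ _) (ℤP.+-identityˡ _) ⟩
          ℤ.- lv q ∎)

  block : ℤ → List Step
  block k = map proj₂ (filterᵇ (λ e → ⌊ proj₁ e ℤ.≟ k ⌋) (labelled a b 0ℤ (reverse π)))

  block-steps : ∀ k → block k ≡ reverse (map proj₂ (filterᵇ (λ e → ⌊ ℤ.- startLevel e ℤ.≟ k ⌋) P))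
  block-steps k = begin
      map proj₂ (filterᵇ has-k (labelled a b 0ℤ (reverse π)))
    ≡⟨ cong (map proj₂ ∘ filterᵇ has-k) labels-rev-π ⟩
      map proj₂ (filterᵇ has-k (reverse (map negated P)))
    ≡⟨ cong (map proj₂) (filterᵇ-reverse has-k (map negated P)) ⟩
      map proj₂ (reverse (filterᵇ has-k (map negated P)))
    ≡⟨ cong (map proj₂ ∘ reverse) (filterᵇ-map has-k negated P) ⟩
      map proj₂ (reverse (map negated (filterᵇ (has-k ∘ negated) P)))
    ≡⟨ ListP.reverse-map proj₂ (map negated (filterᵇ (has-k ∘ negated) P)) ⟩
      reverse (map proj₂ (map negated (filterᵇ (has-k ∘ negated) P)))
    ≡⟨ cong reverse (sym (ListP.map-∘ (filterᵇ (has-k ∘ negated) P))) ⟩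
      reverse (map proj₂ (filterᵇ (has-k ∘ negated) P)) ∎
    where
      has-k : ℤ × Step → Bool
      has-k e = ⌊ proj₁ e ℤ.≟ k ⌋

  block-neg : ∀ j → block (ℤ.- + j) ≡ S j
  block-neg j = begin
      block (ℤ.- + j)
    ≡⟨ block-steps (ℤ.- + j) ⟩
      reverse (map proj₂ (filterᵇ (λ e → ⌊ ℤ.- startLevel e ℤ.≟ ℤ.- + j ⌋) P))
    ≡⟨ cong (reverse ∘ map proj₂) (filterᵇ-cong (λ e → ⌊-≟-⌋ (startLevel e) (+ j)) P) ⟩
      reverse (S j)
    ≡⟨ bucket-reverse startLevel proj₂ distinct (+ j) ⟩
      S j ∎

  -- ... and positive labels do not occur, all levels being non-negative.
  block-pos : ∀ n → 0 < n → block (+ n) ≡ []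
  block-pos n@(suc n-1) _ = trans (block-steps (+ n))
    (cong (reverse ∘ map proj₂) (ListP.filter-none (T? ∘ λ e → ⌊ ℤ.- startLevel e ℤ.≟ + n ⌋)
      (All.tabulate (λ e∈ is-n → neg-nonneg≢pos n-1 (start-nonneg e∈) (toWitness is-n)))))
    where
      start-nonneg : ∀ {e} → e ∈ P → 0ℤ ℤ.≤ startLevel e
      start-nonneg e∈ = visited-nonneg (proj₁ (step-visited (0 , 0) π e∈))

  K : ℕ
  K = (a + b) * length (reverse π)

  swPlus-buckets : swPlus a b (reverse π) ≡ concatMap S (upTo (suc K))
  swPlus-buckets = begin
      concatMap block (map (λ j → ℤ.- + j) (upTo (suc K)) ++ map (λ j → + (K ∸ j)) (upTo K))
    ≡⟨ ListP.concatMap-++ block (map (λ j → ℤ.- + j) (upTo (suc K))) (map (λ j → + (K ∸ j)) (upTo K)) ⟩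
      concatMap block (map (λ j → ℤ.- + j) (upTo (suc K))) ++ concatMap block (map (λ j → + (K ∸ j)) (upTo K))
    ≡⟨ cong₂ _++_ (ListP.concatMap-map block (λ j → ℤ.- + j) (upTo (suc K)))
                  (ListP.concatMap-map block (λ j → + (K ∸ j)) (upTo K)) ⟩
      concatMap (λ j → block (ℤ.- + j)) (upTo (suc K)) ++ concatMap (λ j → block (+ (K ∸ j))) (upTo K)
    ≡⟨ cong₂ _++_ (ListP.concatMap-cong block-neg (upTo (suc K)))
         (concatMap-cong-∈ (upTo K) (λ j∈ → block-pos _ (ℕP.m<n⇒0<n∸m (∈P.∈-upTo⁻ j∈)))) ⟩
      concatMap S (upTo (suc K)) ++ concatMap (λ _ → []) (upTo K)
    ≡⟨ cong (concatMap S (upTo (suc K)) ++_) (concatMap-[] (upTo K)) ⟩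
      concatMap S (upTo (suc K)) ++ []
    ≡⟨ ListP.++-identityʳ _ ⟩
      concatMap S (upTo (suc K)) ∎

  -- An east step ends a below its start, so a step starting below level a is a north step.
  low-start-north : ∀ {e j} → e ∈ P → startLevel e ≡ + j → j < a → proj₂ e ≡ N
  low-start-north {q , N} _ _ _ = refl
  low-start-north {q , E} {j} e∈ lv≡j j<a = ⊥-elim (ℕP.<⇒≱ j<a (nonneg-difference end-nonneg))
    where
      end-nonneg : 0ℤ ℤ.≤ + j ℤ.- + a
      end-nonneg = subst (0ℤ ℤ.≤_) (trans (level-move q E) (cong (ℤ._+ ℤ.- + a) lv≡j))
                     (visited-nonneg (proj₂ (step-visited (0 , 0) π e∈)))

  low-bucket-north : ∀ {j} → j < a → All (_≡ N) (S j)
  low-bucket-north j<a = AllP.map⁺ (All.tabulate λ e∈ →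
    let e∈P , lv≡j = bucket⁻ startLevel e∈ in low-start-north e∈P lv≡j j<a)

  high-bucket-empty : ∀ j → a * b < j → S j ≡ []
  high-bucket-empty j ab<j with bucketView startLevel distinct (+ j)
  ... | empty b≡[] = cong (map proj₂) b≡[]
  ... | singleton ((x , y) , s) e∈ lv≡j _ = ⊥-elim (ℕP.<⇒≱ ab<j (subst (_≤ a * b) level≡j bound))
    where
      q∈ : (x , y) ∈ visited (0 , 0) π
      q∈ = proj₁ (step-visited (0 , 0) π e∈)
      level≡j : b * y ∸ a * x ≡ j
      level≡j = ℤP.+-injective (trans (sym (visited-level q∈)) lv≡j)
      bound : b * y ∸ a * x ≤ a * b
      bound = visited-level-bound q∈

  -- π has a + b steps, so K = (a+b)², which exceeds the levels a + a·b of interest.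
  length-π : length (reverse π) ≡ a + b
  length-π = trans (ListP.length-reverse π) (trans (length-count π) (cong₂ _+_ #N≡a #E≡b))

  K-large : a + suc (a * b) ≤ suc K
  K-large = subst (_≤ suc K) (sym (ℕP.+-suc a (a * b))) (s≤s a+ab≤K)
    where
      -- a + a·b = a·(1 + b) ≤ (a + b)·(a + b) = K
      a+ab≤K : a + a * b ≤ K
      a+ab≤K = subst₂ _≤_ (ℕP.*-suc a b) (cong ((a + b) *_) (sym length-π))
                 (ℕP.*-mono-≤ (ℕP.m≤m+n a b) (ℕP.+-monoˡ-≤ b a≥1))

  concatMap-S-applyUpTo : ∀ f n → concatMap S (applyUpTo f n) ≡ concatMap (S ∘ f) (upTo n)
  concatMap-S-applyUpTo f n = cong concat (trans (ListP.map-applyUpTo f S n) (sym (ListP.map-upTo (S ∘ f) n)))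

  buckets-split : concatMap S (upTo (suc K)) ≡
    concatMap S (upTo a) ++ concatMap (λ i → S (a + i)) (upTo (suc (a * b)))
  buckets-split = begin
      concatMap S (upTo (suc K))
    ≡⟨ cong (concatMap S ∘ upTo) (sym a+n+r≡) ⟩
      concatMap S (upTo (a + (n + r)))
    ≡⟨ cong (concatMap S) (applyUpTo-+ (λ i → i) a (n + r)) ⟩
      concatMap S (upTo a ++ applyUpTo (λ i → a + i) (n + r))
    ≡⟨ ListP.concatMap-++ S (upTo a) _ ⟩
      concatMap S (upTo a) ++ concatMap S (applyUpTo (λ i → a + i) (n + r))
    ≡⟨ cong (λ t → concatMap S (upTo a) ++ concatMap S t) (applyUpTo-+ (λ i → a + i) n r) ⟩
      concatMap S (upTo a) ++ concatMap S (applyUpTo (λ i → a + i) n ++ applyUpTo (λ i → a + (n + i)) r)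
    ≡⟨ cong (concatMap S (upTo a) ++_) (ListP.concatMap-++ S (applyUpTo (λ i → a + i) n) _) ⟩
      concatMap S (upTo a) ++ (concatMap S (applyUpTo (λ i → a + i) n) ++ concatMap S (applyUpTo (λ i → a + (n + i)) r))
    ≡⟨ cong (λ t → concatMap S (upTo a) ++ (concatMap S (applyUpTo (λ i → a + i) n) ++ t)) beyond-empty ⟩
      concatMap S (upTo a) ++ (concatMap S (applyUpTo (λ i → a + i) n) ++ [])
    ≡⟨ cong (λ t → concatMap S (upTo a) ++ t)
         (trans (ListP.++-identityʳ _) (concatMap-S-applyUpTo (λ i → a + i) n)) ⟩
      concatMap S (upTo a) ++ concatMap (λ i → S (a + i)) (upTo n) ∎
    where
      n r : ℕ
      n = suc (a * b)
      r = suc K ∸ (a + n)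
      a+n+r≡ : a + (n + r) ≡ suc K
      a+n+r≡ = trans (sym (ℕP.+-assoc a n r)) (ℕP.m+[n∸m]≡n K-large)
      beyond-empty : concatMap S (applyUpTo (λ i → a + (n + i)) r) ≡ []
      beyond-empty = begin
          concatMap S (applyUpTo (λ i → a + (n + i)) r)
        ≡⟨ concatMap-S-applyUpTo (λ i → a + (n + i)) r ⟩
          concatMap (λ i → S (a + (n + i))) (upTo r)
        ≡⟨ ListP.concatMap-cong (λ i → high-bucket-empty _
             (ℕP.<-≤-trans (ℕP.n<1+n (a * b)) (ℕP.≤-trans (ℕP.m≤m+n n i) (ℕP.m≤n+m _ a)))) (upTo r) ⟩
          concatMap (λ _ → []) (upTo r)
        ≡⟨ concatMap-[] (upTo r) ⟩
          [] ∎

  z-step : ∀ {q s} i → (q , s) ∈ P → lv q ≡ + (a + i) → zWord a b π i ≡ s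
  z-step {s = s} i e∈ lv≡ with step-row 0 0 π e∈
  ... | x , y , refl , row = by-step i s row lv≡ (visited-in-rect (proj₂ (step-visited (0 , 0) π e∈)))
    where
      q∈ : (x , y) ∈ visited (0 , 0) π
      q∈ = proj₁ (step-visited (0 , 0) π e∈)

      ax≤by : a * x ≤ b * y
      ax≤by = level-nonneg (visited-nonneg q∈)

      level≡ : ∀ {i} → lv (x , y) ≡ + (a + i) → b * y ∸ a * x ≡ a + i
      level≡ lv≡ = ℤP.+-injective (trans (sym (visited-level q∈)) lv≡)

      -- the unit square east of the starting point has SE corner (x + 1, y) and level i
      square-level : ∀ {i} → lv (x , y) ≡ + (a + i) → lv (suc x , y) ≡ + i
      square-level {i} lv≡ =
        trans (level-move (x , y) E) (trans (cong (ℤ._+ ℤ.- + a) lv≡) (cancel (+ a) (+ i)))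
        where
          cancel : ∀ (A I : ℤ) → (A ℤ.+ I) ℤ.+ ℤ.- A ≡ I
          cancel = solve-∀

      by-step : ∀ i s → RowNorth s x (eastBeforeN π y) → lv (x , y) ≡ + (a + i) →
        InRect (move (x , y) s) → zWord a b π i ≡ s
      by-step zero E _ _ _ = refl
      by-step zero N _ lv≡ (_ , y<a) = ⊥-elim (no-north-at-level-a x y y<a by≡a[x+1])
        where
          by≡a[x+1] : b * y ≡ a * suc x
          by≡a[x+1] = begin
              b * y                   ≡⟨ sym (ℕP.m∸n+n≡m ax≤by) ⟩
              (b * y ∸ a * x) + a * x ≡⟨ cong (_+ a * x) (trans (level≡ lv≡) (ℕP.+-identityʳ a)) ⟩
              a + a * x               ≡⟨ sym (ℕP.*-suc a x) ⟩
              a * suc x               ∎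
      by-step (suc i) N row lv≡ (_ , y<a) =
        cong (λ t → if t then N else E) (memℤ-true (deltaC a b π) in-Δ)
        where
          x<b : x < b
          x<b = ℕP.*-cancelˡ-< a x b
                  (ℕP.≤-<-trans ax≤by (subst (b * y <_) (ℕP.*-comm b a) (ℕP.*-monoʳ-< b y<a)))
          in-Δ : + suc i ∈ deltaC a b π
          in-Δ = subst (_∈ deltaC a b π) (square-level lv≡)
                   (deltaC⁺ (square⁺ y<a x<b (subst (_< suc x) (sym row) (ℕP.n<1+n x)))
                            (subst (0ℤ ℤ.≤_) (sym (square-level lv≡)) (ℤ.+≤+ ℕ.z≤n)))
      by-step (suc i) E row lv≡ square-in-rect =
        cong (λ t → if t then N else E) (memℤ-false (deltaC a b π) not-in-Δ)
        where
          -- a square of Δ^c with level i + 1 would be this square, which lies west of the path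
          not-in-Δ : ¬ (+ suc i ∈ deltaC a b π)
          not-in-Δ v∈ with deltaC⁻ v∈
          ... | c , c∈ , v≡ with square⁻ c∈
          ... | x' , y' , refl , y'<a , x'<b , east'
            with level-injective (x'<b , ℕP.<⇒≤ y'<a) square-in-rect (trans (sym v≡) (sym (square-level lv≡)))
          ... | inj₁ refl = ℕP.<⇒≱ row (ℕP.≤-pred east')
          ... | inj₂ (inj₁ (() , _))
          ... | inj₂ (inj₂ (c≡ba , _)) = ℕP.<-irrefl (cong proj₂ c≡ba) y'<a

  wsLevels-steps : wsLevels a b π ≡ map startLevel P
  wsLevels-steps = trans (cong (map lv) (sym (steps-starts (0 , 0) π))) (sym (ListP.map-∘ P))

  kept-letter : ∀ i → (if memℤ (+ (i + a)) (wsLevels a b π) then [ zWord a b π i ] else []) ≡ S (a + i)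
  kept-letter i rewrite wsLevels-steps | ℕP.+-comm i a with bucketView startLevel distinct (+ (a + i))
  ... | empty b≡[] = trans (cong (λ t → if t then [ zWord a b π i ] else []) (memℤ-false _ no-start))
                           (sym (cong (map proj₂) b≡[]))
    where
      no-start : ¬ (+ (a + i) ∈ map startLevel P)
      no-start v∈ with ∈P.∈-map⁻ startLevel v∈
      ... | e , e∈ , v≡ with subst (e ∈_) b≡[] (bucket⁺ startLevel e∈ (sym v≡))
      ... | ()
  ... | singleton (q , s) e∈ lv≡ b≡[e] = begin
      (if memℤ (+ (a + i)) (map startLevel P) then [ zWord a b π i ] else [])
    ≡⟨ cong (λ t → if t then [ zWord a b π i ] else [])
         (memℤ-true _ (subst (_∈ map startLevel P) lv≡ (∈P.∈-map⁺ startLevel e∈))) ⟩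
      [ zWord a b π i ]
    ≡⟨ cong [_] (z-step i e∈ lv≡) ⟩
      [ s ]
    ≡⟨ sym (cong (map proj₂) b≡[e]) ⟩
      S (a + i) ∎

  yWord-buckets : yWord a b π ≡ concatMap (λ i → S (a + i)) (upTo (suc (a * b)))
  yWord-buckets = trans (map-filterᵇ _ (zWord a b π) (upTo (suc (a * b))))
                        (ListP.concatMap-cong kept-letter (upTo (suc (a * b))))

  k : ℕ
  k = length (concatMap S (upTo a))

  buckets-word : concatMap S (upTo (suc K)) ≡ replicate k N ++ yWord a b π
  buckets-word = trans buckets-split (cong₂ _++_ (all-replicate N _ low-north) (sym yWord-buckets))
    where
      low-north : All (_≡ N) (concatMap S (upTo a))
      low-north = AllP.concat⁺ (AllP.map⁺ (AllP.applyUpTo⁺₁ id a low-bucket-north))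

  swPlus-rev-π : swPlus a b (reverse π) ≡ replicate k N ++ yWord a b π
  swPlus-rev-π = trans swPlus-buckets buckets-word

  count-all-buckets : ∀ p → count p (concatMap S (upTo (suc K))) ≡ count p π
  count-all-buckets p =
    trans (count-buckets startLevel p proj₂ (suc K) P in-range) (cong (count p) (steps-word (0 , 0) π))
    where
      ab<1+K : a * b < suc K
      ab<1+K = ℕP.<-≤-trans (ℕP.n<1+n (a * b)) (ℕP.≤-trans (ℕP.m≤n+m (suc (a * b)) a) K-large)
      in-range : All (λ e → ∃[ m ] (m < suc K × startLevel e ≡ + m)) P
      in-range = All.tabulate λ { {(x , y) , s} e∈ →
        let q∈ = proj₁ (step-visited (0 , 0) π e∈)
        in b * y ∸ a * x , ℕP.≤-<-trans (visited-level-bound q∈) ab<1+K , visited-level q∈ }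

  count-word : ∀ p → count p (replicate k N) + count p (yWord a b π) ≡ count p π
  count-word p = trans (sym (count-++ p (replicate k N) (yWord a b π)))
                       (trans (cong (count p) (sym buckets-word)) (count-all-buckets p))

  yWord-north : count isN (yWord a b π) + k ≡ a
  yWord-north = begin
      count isN (yWord a b π) + k
    ≡⟨ ℕP.+-comm _ k ⟩
      k + count isN (yWord a b π)
    ≡⟨ cong (_+ count isN (yWord a b π)) (sym (count-north-replicate k)) ⟩
      count isN (replicate k N) + count isN (yWord a b π)
    ≡⟨ count-word isN ⟩
      count isN π
    ≡⟨ #N≡a ⟩
      a ∎

  yWord-east : count isE (yWord a b π) ≡ b
  yWord-east = begin
      count isE (yWord a b π)
    ≡⟨ cong (_+ count isE (yWord a b π)) (sym (count-east-replicate k)) ⟩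
      count isE (replicate k N) + count isE (yWord a b π)
    ≡⟨ count-word isE ⟩
      count isE π
    ≡⟨ #E≡b ⟩
      b ∎

lemma4p10 : (a b : ℕ) → 1 ≤ a → 1 ≤ b → gcd a b ≡ 1 →
    (π : List Step) → InD a b π →
    wordPart a b (rhoTildeFTilde a b π) ≡ swPlus a b (reverse π)
lemma4p10 a b a≥1 b≥1 gcd≡1 π π∈D = begin
    wordPart a b (reverse (positiveParts (yWord a b π)))
  ≡⟨ wordPart-positiveParts a b k (yWord a b π) yWord-north yWord-east ⟩
    replicate k N ++ yWord a b π
  ≡⟨ sym swPlus-rev-π ⟩
    swPlus a b (reverse π) ∎
  where open DyckPath a b a≥1 b≥1 (gcd≡1⇒coprime gcd≡1) π π∈D
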